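{- For all integers $k,m>1$, \[|D^k_{km+1}(321)|=\sum_{i=k(m-1)+2}^{km}|D^k_i(321)|.\]
   Context: A permutation $w\in S_n$ has descent type $k$ if $w_1<w_2<\cdots<w_k>w_{k+1}<\cdots<w_{2k}>w_{2k+1}<\cdots$ (consecutive blocks of $k$ increasing entries, the last block possibly shorter, with a descent between consecutive blocks). $D^k_n(q)$ is the set of permutations of length $n$ of descent type $k$ that avoid the pattern $q$. -}

module Defs where

open import Data.Nat using (ℕ; zero; suc; _+_; _*_; _∸_; _<ᵇ_)
open import Data.Nat.Divisibility using (_∣?_)
open import Data.Bool using (Bool; true; false; _∧_; _∨_; not; if_then_else_)
open import Data.List using (List; []; _∷_; [_]; map; concatMap; upTo; applyUpTo; filter; length)
open import Data.Bool.ListAction using (any)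
open import Relation.Nullary.Decidable using (isYes)
open import Relation.Binary.PropositionalEquality using (_≡_)

-- Permutations of length n are represented in one-line notation as lists
-- w = w₁ … wₙ of natural numbers using each of 0,1,…,n-1 exactly once
-- (values shifted by one; irrelevant for order-based notions).

words : ℕ → ℕ → List (List ℕ)
words zero    a = [ [] ]
words (suc l) a = concatMap (λ x → map (x ∷_) (words l a)) (upTo a)

elemᵇ : ℕ → List ℕ → Bool
elemᵇ x = any (λ y → isYes (Data.Nat._≟_ x y))

distinctᵇ : List ℕ → Bool
distinctᵇ []       = true
distinctᵇ (x ∷ xs) = not (elemᵇ x xs) ∧ distinctᵇ xs

perms : ℕ → List (List ℕ)
perms n = filter (λ w → distinctᵇ w Data.Bool.≟ true) (words n n)

-- Descent type k: for every position i (1-based) with 1 ≤ i < n,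
-- wᵢ > wᵢ₊₁ if k ∣ i, and wᵢ < wᵢ₊₁ otherwise.
-- descTypeFrom k i w checks this for w = wᵢ wᵢ₊₁ …
descTypeFrom : ℕ → ℕ → List ℕ → Bool
descTypeFrom k i []           = true
descTypeFrom k i (x ∷ [])     = true
descTypeFrom k i (x ∷ y ∷ ys) =
  (if isYes (k ∣? i) then y <ᵇ x else x <ᵇ y) ∧ descTypeFrom k (suc i) (y ∷ ys)

hasDescentType : ℕ → List ℕ → Bool
hasDescentType k w = descTypeFrom k 1 w

contains21below : ℕ → List ℕ → Bool
contains21below x []       = false
contains21below x (y ∷ ys) = ((y <ᵇ x) ∧ any (λ z → z <ᵇ y) ys) ∨ contains21below x ys

contains321 : List ℕ → Bool
contains321 []       = false
contains321 (x ∷ xs) = contains21below x xs ∨ contains321 xs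

avoids321 : List ℕ → Bool
avoids321 w = not (contains321 w)

D321 : ℕ → ℕ → List (List ℕ)
D321 k n = filter (λ w → (hasDescentType k w ∧ avoids321 w) Data.Bool.≟ true) (perms n)

d321 : ℕ → ℕ → ℕ
d321 k n = length (D321 k n)

range : ℕ → ℕ → List ℕ
range a b = applyUpTo (a +_) (suc b ∸ a)

-- Put B = k(m-1) and M = km, and index positions from 0, so that a word w of length
-- M+1 ends with x = w_M.  For w ∈ D^k_{M+1}(321) the entries at positions B, …, M-1
-- increase, w_B < x (otherwise w_{B-1} w_B x is a 321) and x < w_{M-1} (descent at M).
-- Let s be the first position after B with x < w_s.  Each entry before s lies below
-- w_s (otherwise it forms a 321 with w_s and x), so the s+1 distinct values
-- w_0 … w_{s-1} x all lie below w_s; an increasing run from w_s ≥ s+1 up to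
-- w_{M-1} ≤ M is then forced to be w_i = i+1 for s ≤ i < M.  Deleting this run
-- ("collapse") is therefore a bijection, inverse to re-inserting it ("expand"), from
-- the words of D^k_{M+1}(321) with cut s onto D^k_{s+1}(321), for every B < s < M.
-- Summing over the cuts gives the formula.
module Submission where

open import Defs
open import Data.Bool using (true; false; _∧_; not; if_then_else_; T) renaming (_≟_ to _≟ᵇ_)
open import Data.Bool.Properties using (T-∧; T-∨; T-≡)
open import Data.Bool.ListAction using (any)
open import Data.Empty using (⊥; ⊥-elim)
open import Data.List using (List; []; _∷_; [_]; _++_; length; map; filter; upTo; applyUpTo)
open import Data.List.Membership.Propositional using (_∈_; find; lose)
open import Data.List.Membership.Propositional.Properties
  using (∈-concatMap⁺; ∈-concatMap⁻; ∈-map⁺; ∈-map⁻; ∈-upTo⁺; ∈-upTo⁻; ∈-applyUpTo⁺; ∈-applyUpTo⁻;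
         ∈-filter⁺; ∈-filter⁻; ∈-∃++)
open import Data.List.Properties
  using (∷-injective; length-++; length-upTo; length-applyUpTo; filter-++; filter-none; map-cong; map-cong-local)
open import Data.List.Relation.Unary.Any using (Any; here; there)
open import Data.List.Relation.Unary.Any.Properties using (any⁺; any⁻)
import Data.List.Relation.Unary.All as All
import Data.List.Relation.Unary.All.Properties as AllP
import Data.List.Relation.Unary.AllPairs as AP
import Data.List.Relation.Unary.AllPairs.Properties as APP
open import Data.List.Relation.Unary.Unique.Propositional using (Unique)
import Data.List.Relation.Unary.Unique.Propositional.Properties as UP
open import Data.Nat using (ℕ; zero; suc; pred; _+_; _*_; _∸_; _<_; _≤_; z≤n; s≤s; _<ᵇ_; _<?_)
open import Data.Nat.Properties
open import Algebra.Properties.CommutativeSemigroup +-commutativeSemigroup using (interchange)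
open import Data.Nat.Divisibility using (_∣_; _∣?_; divides; m∣m*n)
open import Data.Nat.ListAction using (sum)
open import Data.Product using (_×_; _,_; proj₁; proj₂; ∃-syntax)
open import Data.Sum using (inj₁; inj₂; [_,_]′)
open import Data.Unit using (tt)
open import Function using (_∘_; _⇔_; mk⇔; Equivalence)
open import Relation.Binary using (tri<; tri≈; tri>)
open import Relation.Binary.PropositionalEquality using (_≡_; _≢_; refl; sym; trans; cong; cong₂; subst; subst₂)
open import Relation.Nullary using (¬_; Dec; does; yes; no)
open import Relation.Nullary.Decidable using (isYes; toWitness; fromWitness; _×-dec_)

open Equivalence using (to; from)
open Relation.Binary.PropositionalEquality.≡-Reasoning

-- The i-th entry of a word (0-based), with 0 as a default outside the word.
at : List ℕ → ℕ → ℕ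
at []       _       = 0
at (x ∷ xs) zero    = x
at (x ∷ xs) (suc i) = at xs i

at-ext : ∀ (xs ys : List ℕ) → length xs ≡ length ys →
         (∀ i → i < length xs → at xs i ≡ at ys i) → xs ≡ ys
at-ext []       []       _ _  = refl
at-ext (x ∷ xs) (y ∷ ys) e eq =
  cong₂ _∷_ (eq 0 (s≤s z≤n)) (at-ext xs ys (suc-injective e) (λ i i< → eq (suc i) (s≤s i<)))

at-applyUpTo : ∀ (h : ℕ → ℕ) n i → i < n → at (applyUpTo h n) i ≡ h i
at-applyUpTo h (suc n) zero    _        = refl
at-applyUpTo h (suc n) (suc i) (s≤s i<) = at-applyUpTo (λ j → h (suc j)) n i i<

Any⇒at : ∀ {P : ℕ → Set} {xs} → Any P xs → ∃[ i ] (i < length xs × P (at xs i))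
Any⇒at (here p)  = 0 , s≤s z≤n , p
Any⇒at (there a) with i , i< , p ← Any⇒at a = suc i , s≤s i< , p

at⇒Any : ∀ {P : ℕ → Set} xs i → i < length xs → P (at xs i) → Any P xs
at⇒Any (x ∷ xs) zero    _        p = here p
at⇒Any (x ∷ xs) (suc i) (s≤s i<) p = there (at⇒Any xs i i< p)

T-not : ∀ b → T (not b) ⇔ (¬ T b)
T-not true  = mk⇔ (λ ()) (λ ¬t → ¬t tt)
T-not false = mk⇔ (λ _ ()) (λ _ → tt)

T-anyBelow : ∀ y xs → T (any (λ z → z <ᵇ y) xs) ⇔ (∃[ l ] (l < length xs × at xs l < y))
T-anyBelow y xs = mk⇔
  (λ t → let l , l< , t' = Any⇒at (any⁻ _ xs t) in l , l< , <ᵇ⇒< _ y t')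
  (λ (l , l< , lt) → any⁺ _ (at⇒Any xs l l< (<⇒<ᵇ lt)))

T-elemᵇ : ∀ x xs → T (elemᵇ x xs) ⇔ (∃[ i ] (i < length xs × x ≡ at xs i))
T-elemᵇ x xs = mk⇔
  (λ t → let i , i< , t' = Any⇒at (any⁻ _ xs t) in i , i< , toWitness t')
  (λ (i , i< , e) → any⁺ _ (at⇒Any xs i i< (fromWitness e)))

Distinct : List ℕ → Set
Distinct w = ∀ i j → i < j → j < length w → at w i ≢ at w j

T-distinctᵇ : ∀ w → T (distinctᵇ w) ⇔ Distinct w
T-distinctᵇ w = mk⇔ (sound w) (complete w)
  where
  sound : ∀ w → T (distinctᵇ w) → Distinct w
  sound (x ∷ xs) t zero (suc j) _ (s≤s j<) e =
    to (T-not _) (proj₁ (to T-∧ t)) (from (T-elemᵇ x xs) (j , j< , e))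
  sound (x ∷ xs) t (suc i) (suc j) (s≤s i<j) (s≤s j<) =
    sound xs (proj₂ (to T-∧ t)) i j i<j j<
  complete : ∀ w → Distinct w → T (distinctᵇ w)
  complete []       _ = tt
  complete (x ∷ xs) d = from T-∧
    ( from (T-not _) (λ t → let j , j< , e = to (T-elemᵇ x xs) t in d 0 (suc j) (s≤s z≤n) (s≤s j<) e)
    , complete xs (λ i j i<j j< → d (suc i) (suc j) (s≤s i<j) (s≤s j<)) )

-- The comparison required between consecutive entries a, b whose left one sits at
-- 1-based position p: a descent when k ∣ p, an ascent otherwise.
Step : ℕ → ℕ → ℕ → ℕ → Set
Step k p a b = (k ∣ p → b < a) × (¬ k ∣ p → a < b)

T-step : ∀ k p a b → T (if isYes (k ∣? p) then b <ᵇ a else a <ᵇ b) ⇔ Step k p a b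
T-step k p a b with k ∣? p
... | yes k∣p = mk⇔ (λ t → (λ _ → <ᵇ⇒< b a t) , (λ k∤p → ⊥-elim (k∤p k∣p)))
                   (λ st → <⇒<ᵇ (proj₁ st k∣p))
... | no  k∤p = mk⇔ (λ t → (λ k∣p → ⊥-elim (k∤p k∣p)) , (λ _ → <ᵇ⇒< a b t))
                   (λ st → <⇒<ᵇ (proj₂ st k∤p))

ShapeFrom : ℕ → ℕ → List ℕ → Set
ShapeFrom k i w = ∀ j → suc j < length w → Step k (i + j) (at w j) (at w (suc j))

T-descTypeFrom : ∀ k i w → T (descTypeFrom k i w) ⇔ ShapeFrom k i w
T-descTypeFrom k i w = mk⇔ (sound i w) (complete i w)
  where
  sound : ∀ i w → T (descTypeFrom k i w) → ShapeFrom k i w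
  sound i (x ∷ [])     t zero (s≤s ())
  sound i (x ∷ y ∷ ys) t zero _ =
    subst (λ p → Step k p x y) (sym (+-identityʳ i)) (to (T-step k i x y) (proj₁ (to T-∧ t)))
  sound i (x ∷ y ∷ ys) t (suc j) (s≤s j<) =
    subst (λ p → Step k p (at (y ∷ ys) j) (at ys j)) (sym (+-suc i j))
      (sound (suc i) (y ∷ ys) (proj₂ (to T-∧ t)) j j<)
  complete : ∀ i w → ShapeFrom k i w → T (descTypeFrom k i w)
  complete i []           _  = tt
  complete i (x ∷ [])     _  = tt
  complete i (x ∷ y ∷ ys) sh = from T-∧
    ( from (T-step k i x y) (subst (λ p → Step k p x y) (+-identityʳ i) (sh 0 (s≤s (s≤s z≤n))))
    , complete (suc i) (y ∷ ys) (λ j j< →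
        subst (λ p → Step k p (at (y ∷ ys) j) (at ys j)) (+-suc i j) (sh (suc j) (s≤s j<))) )

Below21 : ℕ → List ℕ → Set
Below21 x ys = ∃[ j ] ∃[ l ] (j < l × l < length ys × at ys j < x × at ys l < at ys j)

Has321 : List ℕ → Set
Has321 w = ∃[ i ] ∃[ j ] ∃[ l ]
  (i < j × j < l × l < length w × at w j < at w i × at w l < at w j)

T-contains21below : ∀ x ys → T (contains21below x ys) ⇔ Below21 x ys
T-contains21below x ys = mk⇔ (sound ys) (complete ys)
  where
  sound : ∀ ys → T (contains21below x ys) → Below21 x ys
  sound (y ∷ ys) t with to T-∨ t
  ... | inj₁ t₁ = let y<x , t₂ = to T-∧ t₁ ; l , l< , zy = to (T-anyBelow y ys) t₂
                  in 0 , suc l , s≤s z≤n , s≤s l< , <ᵇ⇒< y x y<x , zy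
  ... | inj₂ t₂ = let j , l , j<l , l< , yx , zy = sound ys t₂
                  in suc j , suc l , s≤s j<l , s≤s l< , yx , zy
  complete : ∀ ys → Below21 x ys → T (contains21below x ys)
  complete (y ∷ ys) (zero , suc l , _ , s≤s l< , yx , zy) =
    from T-∨ (inj₁ (from T-∧ (<⇒<ᵇ yx , from (T-anyBelow y ys) (l , l< , zy))))
  complete (y ∷ ys) (suc j , suc l , s≤s j<l , s≤s l< , yx , zy) =
    from T-∨ (inj₂ (complete ys (j , l , j<l , l< , yx , zy)))

T-contains321 : ∀ w → T (contains321 w) ⇔ Has321 w
T-contains321 w = mk⇔ (sound w) (complete w)
  where
  sound : ∀ w → T (contains321 w) → Has321 w
  sound (x ∷ xs) t with to T-∨ t
  ... | inj₁ t₁ = let j , l , j<l , l< , yx , zy = to (T-contains21below x xs) t₁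
                  in 0 , suc j , suc l , s≤s z≤n , s≤s j<l , s≤s l< , yx , zy
  ... | inj₂ t₂ = let i , j , l , i<j , j<l , l< , yx , zy = sound xs t₂
                  in suc i , suc j , suc l , s≤s i<j , s≤s j<l , s≤s l< , yx , zy
  complete : ∀ w → Has321 w → T (contains321 w)
  complete (x ∷ xs) (zero , suc j , suc l , _ , s≤s j<l , s≤s l< , yx , zy) =
    from T-∨ (inj₁ (from (T-contains21below x xs) (j , l , j<l , l< , yx , zy)))
  complete (x ∷ xs) (suc i , suc j , suc l , s≤s i<j , s≤s j<l , s≤s l< , yx , zy) =
    from T-∨ (inj₂ (complete xs (i , j , l , i<j , j<l , l< , yx , zy)))

∈words⇔ : ∀ l a w → w ∈ words l a ⇔ (length w ≡ l × (∀ i → i < l → at w i < a))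
∈words⇔ l a w = mk⇔ (sound l w) (complete l w)
  where
  sound : ∀ l w → w ∈ words l a → length w ≡ l × (∀ i → i < l → at w i < a)
  sound zero    .[] (here refl) = refl , λ _ ()
  sound (suc l) w w∈
    with x , x∈ , w∈x ← find (∈-concatMap⁻ (λ x → map (x ∷_) (words l a)) {xs = upTo a} w∈)
    with v , v∈ , refl ← ∈-map⁻ (x ∷_) w∈x
    with len , bd ← sound l v v∈
    = cong suc len , λ { zero _ → ∈-upTo⁻ x∈ ; (suc i) (s≤s i<) → bd i i< }
  complete : ∀ l w → length w ≡ l × (∀ i → i < l → at w i < a) → w ∈ words l a
  complete zero    []      _          = here refl
  complete (suc l) (x ∷ w) (len , bd) =
    ∈-concatMap⁺ (λ x → map (x ∷_) (words l a)) {xs = upTo a}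
      (lose (∈-upTo⁺ (bd 0 (s≤s z≤n)))
            (∈-map⁺ (x ∷_) (complete l w (suc-injective len , λ i i< → bd (suc i) (s≤s i<)))))

record IsD321 (k n : ℕ) (w : List ℕ) : Set where
  field
    length≡  : length w ≡ n
    bounded  : ∀ i → i < n → at w i < n
    distinct : ∀ i j → i < j → j < n → at w i ≢ at w j
    shape    : ∀ j → suc j < n → Step k (suc j) (at w j) (at w (suc j))
    avoids   : ∀ i j l → i < j → j < l → l < n → at w j < at w i → at w l < at w j → ⊥

∈D321⇔ : ∀ k n w → w ∈ D321 k n ⇔ IsD321 k n w
∈D321⇔ k n w = mk⇔ sound complete
  where
  testD : ∀ w → Dec ((hasDescentType k w ∧ avoids321 w) ≡ true)
  testD w = (hasDescentType k w ∧ avoids321 w) ≟ᵇ true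
  testP : ∀ w → Dec (distinctᵇ w ≡ true)
  testP w = distinctᵇ w ≟ᵇ true
  sound : w ∈ D321 k n → IsD321 k n w
  sound w∈
    with w∈perms , tD ← ∈-filter⁻ testD {xs = perms n} w∈
    with w∈words , tP ← ∈-filter⁻ testP {xs = words n n} w∈perms
    with refl , bd ← to (∈words⇔ n n w) w∈words
    with tS , tA ← to T-∧ (from T-≡ tD)
    = record
    { length≡  = refl
    ; bounded  = bd
    ; distinct = to (T-distinctᵇ w) (from T-≡ tP)
    ; shape    = to (T-descTypeFrom k 1 w) tS
    ; avoids   = λ i j l i<j j<l l< ji lj → to (T-not _) tA (from (T-contains321 w) (i , j , l , i<j , j<l , l< , ji , lj))
    }
  complete : IsD321 k n w → w ∈ D321 k n
  complete d with refl ← IsD321.length≡ d = ∈-filter⁺ testD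
    (∈-filter⁺ testP (from (∈words⇔ n n w) (refl , bounded)) (to T-≡ (from (T-distinctᵇ w) distinct)))
    (to T-≡ (from T-∧ (from (T-descTypeFrom k 1 w) shape , from (T-not _) λ t →
      let i , j , l , i<j , j<l , l< , ji , lj = to (T-contains321 w) t in avoids i j l i<j j<l l< ji lj)))
    where open IsD321 d

words-unique : ∀ l a → Unique (words l a)
words-unique zero    a = All.[] AP.∷ AP.[]
words-unique (suc l) a = UP.concat⁺
  (AllP.map⁺ (All.tabulate λ _ → UP.map⁺ (λ e → proj₂ (∷-injective e)) (words-unique l a)))
  (APP.map⁺ (AP.map (λ x≢y {v} (v∈x , v∈y) → x≢y (sameHead v∈x v∈y)) (UP.upTo⁺ a)))
  where
  sameHead : ∀ {x y v} → v ∈ map (x ∷_) (words l a) → v ∈ map (y ∷_) (words l a) → x ≡ y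
  sameHead v∈x v∈y with _ , _ , refl ← ∈-map⁻ _ v∈x | _ , _ , e ← ∈-map⁻ _ v∈y = proj₁ (∷-injective e)

D321-unique : ∀ k n → Unique (D321 k n)
D321-unique k n = UP.filter⁺ _ (UP.filter⁺ _ (words-unique n n))

private
  ∈-delete : ∀ {A : Set} {v u : A} as bs → v ∈ as ++ u ∷ bs → v ≢ u → v ∈ as ++ bs
  ∈-delete []       bs (here refl) v≢u = ⊥-elim (v≢u refl)
  ∈-delete []       bs (there v∈)  _   = v∈
  ∈-delete (a ∷ as) bs (here refl) _   = here refl
  ∈-delete (a ∷ as) bs (there v∈)  v≢u = there (∈-delete as bs v∈ v≢u)

length-≤-injection : ∀ {A B : Set} (xs : List A) (ys : List B) (f : A → B) → Unique xs →
  (∀ {x} → x ∈ xs → f x ∈ ys) → (∀ {x y} → x ∈ xs → y ∈ xs → f x ≡ f y → x ≡ y) →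
  length xs ≤ length ys
length-≤-injection []       ys f _               _    _   = z≤n
length-≤-injection (x ∷ xs) ys f (x∉xs AP.∷ xs!) into inj with as , bs , refl ← ∈-∃++ (into (here refl)) =
  ≤-trans (s≤s (length-≤-injection xs (as ++ bs) f xs! into' (λ p q → inj (there p) (there q))))
          (≤-reflexive (sym (length-++-∷ as)))
  where
  into' : ∀ {y} → y ∈ xs → f y ∈ as ++ bs
  into' y∈ = ∈-delete as bs (into (there y∈)) λ e → All.lookup x∉xs y∈ (inj (here refl) (there y∈) (sym e))
  length-++-∷ : ∀ as → length (as ++ f x ∷ bs) ≡ suc (length (as ++ bs))
  length-++-∷ []       = refl
  length-++-∷ (_ ∷ as) = cong suc (length-++-∷ as)

length-≡-bijection : ∀ {A B : Set} (xs : List A) (ys : List B) (f : A → B) (g : B → A) →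
  Unique xs → Unique ys → (∀ {x} → x ∈ xs → f x ∈ ys) → (∀ {y} → y ∈ ys → g y ∈ xs) →
  (∀ {x} → x ∈ xs → g (f x) ≡ x) → (∀ {y} → y ∈ ys → f (g y) ≡ y) → length xs ≡ length ys
length-≡-bijection xs ys f g xs! ys! f∈ g∈ gf fg = ≤-antisym
  (length-≤-injection xs ys f xs! f∈ (λ p q e → trans (sym (gf p)) (trans (cong g e) (gf q))))
  (length-≤-injection ys xs g ys! g∈ (λ p q e → trans (sym (fg p)) (trans (cong f e) (fg q))))

pigeonhole : ∀ n a (h : ℕ → ℕ) → (∀ i → i < n → h i < a) →
  (∀ i j → i < j → j < n → h i ≢ h j) → n ≤ a
pigeonhole n a h bound distinct = subst₂ _≤_ (length-upTo n) (length-upTo a)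
  (length-≤-injection (upTo n) (upTo a) h (UP.upTo⁺ n) (λ i∈ → ∈-upTo⁺ (bound _ (∈-upTo⁻ i∈))) inj)
  where
  inj : ∀ {i j} → i ∈ upTo n → j ∈ upTo n → h i ≡ h j → i ≡ j
  inj {i} {j} i∈ j∈ e with <-cmp i j
  ... | tri< i<j _ _ = ⊥-elim (distinct i j i<j (∈-upTo⁻ j∈) e)
  ... | tri≈ _ i≡j _ = i≡j
  ... | tri> _ _ j<i = ⊥-elim (distinct j i j<i (∈-upTo⁻ i∈) (sym e))

length-by-classes : ∀ {A B : Set} (P : B → A → Set) (P? : ∀ r w → Dec (P r w)) (R : List B) (L : List A) →
  (∀ {w} → w ∈ L → length (filter (λ r → P? r w) R) ≡ 1) →
  length L ≡ sum (map (λ r → length (filter (P? r) L)) R)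
length-by-classes P P? R []       _   = sym (sum-zeros R)
  where
  sum-zeros : ∀ R → sum (map (λ _ → 0) R) ≡ 0
  sum-zeros []      = refl
  sum-zeros (_ ∷ R) = sum-zeros R
length-by-classes P P? R (w ∷ L) one = sym (begin
  sum (map (λ r → length (filter (P? r) (w ∷ L))) R)
    ≡⟨ cong sum (map-cong (λ r → split-head (P? r)) R) ⟩
  sum (map (λ r → length (filter (P? r) [ w ]) + length (filter (P? r) L)) R)
    ≡⟨ sum-map-+ R ⟩
  sum (map (λ r → length (filter (P? r) [ w ])) R) + sum (map (λ r → length (filter (P? r) L)) R)
    ≡⟨ cong₂ _+_ (trans (classes-of-w R) (one (here refl))) (sym (length-by-classes P P? R L (λ p → one (there p)))) ⟩
  suc (length L) ∎)
  where
  split-head : ∀ {Q : _ → Set} (Q? : ∀ x → Dec (Q x)) →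
    length (filter Q? (w ∷ L)) ≡ length (filter Q? [ w ]) + length (filter Q? L)
  split-head Q? = trans (cong length (filter-++ Q? [ w ] L)) (length-++ (filter Q? [ w ]))
  sum-map-+ : ∀ {X : Set} {f g : X → ℕ} R → sum (map (λ r → f r + g r) R) ≡ sum (map f R) + sum (map g R)
  sum-map-+ []                = refl
  sum-map-+ {f = f} {g} (r ∷ R) = trans (cong (f r + g r +_) (sum-map-+ R)) (interchange (f r) (g r) _ _)
  classes-of-w : ∀ R → sum (map (λ r → length (filter (P? r) [ w ])) R) ≡ length (filter (λ r → P? r w) R)
  classes-of-w []      = refl
  classes-of-w (r ∷ R) with does (P? r w)
  ... | true  = cong suc (classes-of-w R)
  ... | false = classes-of-w R

filter-unique-one : ∀ {A : Set} {Q : A → Set} (Q? : ∀ x → Dec (Q x)) (R : List A) (r₀ : A) → Unique R →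
  r₀ ∈ R → Q r₀ → (∀ {r} → r ∈ R → Q r → r ≡ r₀) → length (filter Q? R) ≡ 1
filter-unique-one Q? (r ∷ R) r₀ (r∉R AP.∷ R!) r₀∈ Qr₀ only with Q? r
... | yes Qr = cong (suc ∘ length) (filter-none Q? (All.tabulate λ r'∈ Qr' →
                 All.lookup r∉R r'∈ (trans (only (here refl) Qr) (sym (only (there r'∈) Qr')))))
... | no ¬Qr with r₀∈
...   | here refl = ⊥-elim (¬Qr Qr₀)
...   | there r₀∈R = filter-unique-one Q? R r₀ R! r₀∈R Qr₀ (λ p → only (there p))

∈-range⇔ : ∀ a b r → r ∈ range a b ⇔ (a ≤ r × r ≤ b)
∈-range⇔ a b r = mk⇔ sound complete
  where
  sound : r ∈ range a b → a ≤ r × r ≤ b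
  sound r∈ with i , i< , refl ← ∈-applyUpTo⁻ (a +_) r∈ =
    m≤m+n a i , ≤-pred (subst (_≤ suc b) (cong suc (+-comm i a)) (m≤o∸n⇒m+n≤o (suc i) a≤1+b i<))
    where
    a≤1+b : a ≤ suc b
    a≤1+b = <⇒≤ (m∸n≢0⇒n<m (λ e → <⇒≱ i< (subst (_≤ i) (sym e) z≤n)))
  complete : a ≤ r × r ≤ b → r ∈ range a b
  complete (a≤r , r≤b) = subst (_∈ range a b) (m+[n∸m]≡n a≤r)
    (∈-applyUpTo⁺ (a +_) (m+n≤o⇒m≤o∸n (suc (r ∸ a)) (s≤s (≤-trans (≤-reflexive (m∸n+n≡m a≤r)) r≤b))))

range-unique : ∀ a b → Unique (range a b)
range-unique a b = UP.applyUpTo⁺₁ (a +_) (suc b ∸ a) (λ i<j _ → <⇒≢ i<j ∘ +-cancelˡ-≡ a _ _)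

module _ {Q : ℕ → Set} (Q? : ∀ i → Dec (Q i)) where

  least-witness-from : ∀ b d → Q (b + d) →
    ∃[ s ] (b ≤ s × s ≤ b + d × Q s × (∀ i → b ≤ i → i < s → ¬ Q i))
  least-witness-from b zero    Qb = b , ≤-refl , m≤m+n b 0 , subst Q (+-identityʳ b) Qb , λ i b≤i i<b _ → <⇒≱ i<b b≤i
  least-witness-from b (suc d) Qe with Q? b
  ... | yes Qb = b , ≤-refl , m≤m+n b (suc d) , Qb , λ i b≤i i<b _ → <⇒≱ i<b b≤i
  ... | no ¬Qb with s , b<s , s≤ , Qs , least ← least-witness-from (suc b) d (subst Q (+-suc b d) Qe)
    = s , <⇒≤ b<s , subst (s ≤_) (sym (+-suc b d)) s≤ , Qs ,
      λ i b≤i i<s → [ (λ b<i → least i b<i i<s) , (λ { refl → ¬Qb }) ]′ (m≤n⇒m<n∨m≡n b≤i)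

  least-witness : ∀ b e → b ≤ e → Q e →
    ∃[ s ] (b ≤ s × s ≤ e × Q s × (∀ i → b ≤ i → i < s → ¬ Q i))
  least-witness b e b≤e Qe
    with s , b≤s , s≤ , Qs , least ← least-witness-from b (e ∸ b) (subst Q (sym (m+[n∸m]≡n b≤e)) Qe)
    = s , b≤s , subst (s ≤_) (m+[n∸m]≡n b≤e) s≤ , Qs , least

IncreasingOn : (ℕ → ℕ) → ℕ → ℕ → Set
IncreasingOn f a b = ∀ i → a ≤ i → suc i ≤ b → f i < f (suc i)

increasing-gap : ∀ f a b → IncreasingOn f a b → ∀ i d → a ≤ i → i + d ≤ b → f i + d ≤ f (i + d)
increasing-gap f a b inc i zero    _   _  = subst₂ _≤_ (sym (+-identityʳ (f i))) (cong f (sym (+-identityʳ i))) ≤-refl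
increasing-gap f a b inc i (suc d) a≤i le = subst₂ _≤_ (sym (+-suc (f i) d)) (cong f (sym (+-suc i d)))
  (≤-trans (s≤s (increasing-gap f a b inc i d a≤i (≤-trans (n≤1+n (i + d)) le′)))
           (inc (i + d) (≤-trans a≤i (m≤m+n i d)) le′))
  where
  le′ : suc (i + d) ≤ b
  le′ = subst (_≤ b) (+-suc i d) le

increasing-squeeze : ∀ f a b c → IncreasingOn f a b → c + a ≤ f a → f b ≤ c + b →
  ∀ i → a ≤ i → i ≤ b → f i ≡ c + i
increasing-squeeze f a b c inc start end i a≤i i≤b = ≤-antisym upper lower
  where
  i=a+[i-a] : a + (i ∸ a) ≡ i
  i=a+[i-a] = m+[n∸m]≡n a≤i
  b=i+[b-i] : i + (b ∸ i) ≡ b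
  b=i+[b-i] = m+[n∸m]≡n i≤b
  lower : c + i ≤ f i
  lower = subst₂ _≤_ (trans (+-assoc c a (i ∸ a)) (cong (c +_) i=a+[i-a])) (cong f i=a+[i-a])
    (≤-trans (+-monoˡ-≤ (i ∸ a) start)
             (increasing-gap f a b inc a (i ∸ a) ≤-refl (subst (_≤ b) (sym i=a+[i-a]) i≤b)))
  upper : f i ≤ c + i
  upper = +-cancelʳ-≤ (b ∸ i) (f i) (c + i)
    (≤-trans (subst (λ j → f i + (b ∸ i) ≤ f j) b=i+[b-i]
                    (increasing-gap f a b inc i (b ∸ i) a≤i (≤-reflexive b=i+[b-i])))
             (subst (f b ≤_) (sym (trans (+-assoc c i (b ∸ i)) (cong (c +_) b=i+[b-i]))) end))

if-< : ∀ {A : Set} {i c} {a b : A} → i < c → (if i <ᵇ c then a else b) ≡ a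
if-< {i = i} {c} i<c with i <ᵇ c in eq
... | true  = refl
... | false = ⊥-elim (subst T eq (<⇒<ᵇ i<c))

if-≥ : ∀ {A : Set} {i c} {a b : A} → c ≤ i → (if i <ᵇ c then a else b) ≡ b
if-≥ {i = i} {c} c≤i with i <ᵇ c in eq
... | true  = ⊥-elim (<⇒≱ (<ᵇ⇒< i c (subst T (sym eq) tt)) c≤i)
... | false = refl

suc-pred-pos : ∀ {a n} → a < n → suc (pred n) ≡ n
suc-pred-pos {n = suc n} _ = refl

pred-<-pos : ∀ {a n} → a < n → pred n < n
pred-<-pos {n = suc n} _ = n<1+n n

≤-pred-of : ∀ {a n} → a < n → a ≤ pred n
≤-pred-of {n = suc n} a<n = ≤-pred a<n

no-multiple-between : ∀ k a p → k * a < p → p < k * suc a → ¬ k ∣ p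
no-multiple-between k a p k*a<p p<k*[a+1] (divides q refl) =
  <⇒≱ (*-cancelˡ-< k a q (subst (k * a <_) (*-comm q k) k*a<p))
      (≤-pred (*-cancelˡ-< k q (suc a) (subst (_< k * suc a) (*-comm q k) p<k*[a+1])))

-- The argument for consecutive multiples B < M of k, passed as B-1 and M-1 so that both
-- are positive.  Positions are 0-based; in D^k_{M+1}(321) the entries at positions
-- B, …, M-1 increase and descents sit between positions B-1, B and M-1, M.
module Splitting (k B-1 M-1 : ℕ) (B<M : suc B-1 < suc M-1) (k∣B : k ∣ suc B-1) (k∣M : k ∣ suc M-1)
                 (no-multiple : ∀ p → suc B-1 < p → p < suc M-1 → ¬ k ∣ p) where

  B M : ℕ
  B = suc B-1
  M = suc M-1

  ascent : ∀ {p a b} → B < p → p < M → a < b → Step k p a b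
  ascent B<p p<M a<b = (λ k∣p → ⊥-elim (no-multiple _ B<p p<M k∣p)) , (λ _ → a<b)

  descent : ∀ {p a b} → k ∣ p → b < a → Step k p a b
  descent k∣p b<a = (λ _ → b<a) , (λ k∤p → ⊥-elim (k∤p k∣p))

  -- The class of a word w of length M+1: its last entry x sits between the entries at
  -- positions s-1 and s.  For w ∈ D^k_{M+1}(321) exactly one s with B < s < M qualifies.
  CutAt : ℕ → List ℕ → Set
  CutAt s w = at w (pred s) < at w M × at w M < at w s

  CutAt? : ∀ s w → Dec (CutAt s w)
  CutAt? s w = (at w (pred s) <? at w M) ×-dec (at w M <? at w s)

  -- w₀ … w_{s-1} w_M : delete the run at positions s, …, M-1.
  collapseEntry : ℕ → List ℕ → ℕ → ℕ
  collapseEntry s w i = if i <ᵇ s then at w i else at w M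

  collapse : ℕ → List ℕ → List ℕ
  collapse s w = applyUpTo (collapseEntry s w) (suc s)

  -- v₀ … v_{s-1} (s+1) (s+2) … M v_s : insert the run of values s+1, …, M before the last entry.
  expandEntry : ℕ → List ℕ → ℕ → ℕ
  expandEntry s v i = if i <ᵇ s then at v i else if i <ᵇ M then suc i else at v s

  expand : ℕ → List ℕ → List ℕ
  expand s v = applyUpTo (expandEntry s v) (suc M)

  collapse-before : ∀ s w i → i < s → at (collapse s w) i ≡ at w i
  collapse-before s w i i<s = trans (at-applyUpTo (collapseEntry s w) (suc s) i (<-trans i<s (n<1+n s))) (if-< i<s)

  collapse-final : ∀ s w → at (collapse s w) s ≡ at w M
  collapse-final s w = trans (at-applyUpTo (collapseEntry s w) (suc s) s (n<1+n s)) (if-≥ {i = s} ≤-refl)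

  module _ {s : ℕ} (s<M : s < M) (v : List ℕ) where
    expand-before : ∀ i → i < s → at (expand s v) i ≡ at v i
    expand-before i i<s = trans (at-applyUpTo (expandEntry s v) (suc M) i (<-trans (<-trans i<s s<M) (n<1+n M))) (if-< i<s)

    expand-inside : ∀ i → s ≤ i → i < M → at (expand s v) i ≡ suc i
    expand-inside i s≤i i<M =
      trans (at-applyUpTo (expandEntry s v) (suc M) i (<-trans i<M (n<1+n M))) (trans (if-≥ s≤i) (if-< i<M))

    expand-final : at (expand s v) M ≡ at v s
    expand-final = trans (at-applyUpTo (expandEntry s v) (suc M) M (n<1+n M)) (trans (if-≥ (<⇒≤ s<M)) (if-≥ {i = M} ≤-refl))

  data Region (s i : ℕ) : Set where
    before : i < s → Region s i
    inside : s ≤ i → i < M → Region s i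
    final  : i ≡ M → Region s i

  region : ∀ s i → i < suc M → Region s i
  region s i i≤M with i <? s
  ... | yes i<s = before i<s
  ... | no  i≮s with m≤n⇒m<n∨m≡n (≤-pred i≤M)
  ...   | inj₁ i<M = inside (≮⇒≥ i≮s) i<M
  ...   | inj₂ i≡M = final i≡M

  module Expand (s : ℕ) (B<s : B < s) (s<M : s < M) (v : List ℕ) (dv : IsD321 k (suc s) v) where
    open IsD321 dv

    private
      E : ℕ → ℕ
      E = at (expand s v)

      -- the entries of v are at most s, below every value of the inserted run
      v≤s : ∀ i → i ≤ s → at v i < suc s
      v≤s i i≤s = bounded i (s≤s i≤s)

      ≤s<run : ∀ {a} i → s ≤ i → a < suc s → a < suc i
      ≤s<run i s≤i a<ss = <-≤-trans a<ss (s≤s s≤i)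

    expand-isD321 : IsD321 k (suc M) (expand s v)
    expand-isD321 = record
      { length≡ = length-applyUpTo (expandEntry s v) (suc M)
      ; bounded = bounded′ ; distinct = distinct′ ; shape = shape′ ; avoids = avoids′ }
      where
      bounded′ : ∀ i → i < suc M → E i < suc M
      bounded′ i i< with region s i i<
      ... | before i<s     rewrite expand-before s<M v i i<s = ≤s<run M (<⇒≤ s<M) (v≤s i (<⇒≤ i<s))
      ... | inside s≤i i<M rewrite expand-inside s<M v i s≤i i<M = s≤s i<M
      ... | final refl     rewrite expand-final s<M v = ≤s<run M (<⇒≤ s<M) (v≤s s ≤-refl)

      distinct′ : ∀ i j → i < j → j < suc M → E i ≢ E j
      distinct′ i j i<j j< with region s i (<-trans i<j j<) | region s j j<
      ... | before i<s | before j<s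
        rewrite expand-before s<M v i i<s | expand-before s<M v j j<s = distinct i j i<j (<-trans j<s (n<1+n s))
      ... | before i<s | inside s≤j j<M
        rewrite expand-before s<M v i i<s | expand-inside s<M v j s≤j j<M = <⇒≢ (≤s<run j s≤j (v≤s i (<⇒≤ i<s)))
      ... | before i<s | final refl
        rewrite expand-before s<M v i i<s | expand-final s<M v = distinct i s i<s (n<1+n s)
      ... | inside s≤i _ | before j<s = ⊥-elim (<⇒≱ (<-trans i<j j<s) s≤i)
      ... | inside s≤i i<M | inside s≤j j<M
        rewrite expand-inside s<M v i s≤i i<M | expand-inside s<M v j s≤j j<M = <⇒≢ (s≤s i<j)
      ... | inside s≤i i<M | final refl
        rewrite expand-inside s<M v i s≤i i<M | expand-final s<M v = >⇒≢ (≤s<run i s≤i (v≤s s ≤-refl))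
      ... | final refl | _ = ⊥-elim (<⇒≱ i<j (≤-pred j<))

      shape′ : ∀ j → suc j < suc M → Step k (suc j) (E j) (E (suc j))
      shape′ j sj< with <-cmp (suc j) s
      ... | tri< sj<s _ _ rewrite expand-before s<M v j (<-trans (n<1+n j) sj<s) | expand-before s<M v (suc j) sj<s =
        shape j (<-trans sj<s (n<1+n s))
      ... | tri≈ _ sj≡s _ rewrite expand-before s<M v j (subst (j <_) sj≡s (n<1+n j))
                                | expand-inside s<M v (suc j) (≤-reflexive (sym sj≡s)) (subst (_< M) (sym sj≡s) s<M) =
        ascent (subst (B <_) (sym sj≡s) B<s) (subst (_< M) (sym sj≡s) s<M)
               (subst (λ t → at v j < suc t) (sym sj≡s) (v≤s j (<⇒≤ (subst (j <_) sj≡s (n<1+n j)))))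
      ... | tri> _ _ s<sj with m≤n⇒m<n∨m≡n (≤-pred sj<)
      ...   | inj₁ sj<M rewrite expand-inside s<M v j (≤-pred s<sj) (<-trans (n<1+n j) sj<M)
                              | expand-inside s<M v (suc j) (<⇒≤ s<sj) sj<M =
        ascent (<-trans B<s s<sj) sj<M (n<1+n (suc j))
      ...   | inj₂ refl rewrite expand-inside s<M v j (≤-pred s<sj) (n<1+n j) | expand-final s<M v =
        descent k∣M (≤s<run j (≤-pred s<sj) (v≤s s ≤-refl))

      avoids′ : ∀ i j l → i < j → j < l → l < suc M → E j < E i → E l < E j → ⊥
      avoids′ i j l i<j j<l l< ji lj with region s j (<-trans j<l l<)
      ... | final refl = <⇒≱ j<l (≤-pred l<)
      ... | inside s≤j j<M rewrite expand-inside s<M v j s≤j j<M with region s i (<-trans i<j (<-trans j<l l<))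
      ...   | before i<s rewrite expand-before s<M v i i<s = <-asym ji (≤s<run j s≤j (v≤s i (<⇒≤ i<s)))
      ...   | inside s≤i i<M rewrite expand-inside s<M v i s≤i i<M = <-asym ji (s≤s i<j)
      ...   | final refl = <⇒≱ (<-trans i<j j<M) ≤-refl
      avoids′ i j l i<j j<l l< ji lj | before j<s
        rewrite expand-before s<M v j j<s | expand-before s<M v i (<-trans i<j j<s) with region s l l<
      ... | before l<s rewrite expand-before s<M v l l<s = avoids i j l i<j j<l (<-trans l<s (n<1+n s)) ji lj
      ... | inside s≤l l<M rewrite expand-inside s<M v l s≤l l<M = <-asym lj (≤s<run l s≤l (v≤s j (<⇒≤ j<s)))
      ... | final refl rewrite expand-final s<M v = avoids i j s i<j j<s (n<1+n s) ji lj

    expand-cut : CutAt s (expand s v)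
    expand-cut
      rewrite expand-before s<M v (pred s) (pred-<-pos B<s) | expand-final s<M v | expand-inside s<M v s ≤-refl s<M =
      proj₂ (subst (λ p → Step k p (at v (pred s)) (at v p)) (suc-pred-pos B<s)
                   (shape (pred s) (s≤s (subst (_≤ s) (sym (suc-pred-pos B<s)) ≤-refl))))
            (no-multiple s B<s s<M)
      , v≤s s ≤-refl

    collapse-expand : collapse s (expand s v) ≡ v
    collapse-expand = at-ext (collapse s (expand s v)) v
      (trans (length-applyUpTo (collapseEntry s (expand s v)) (suc s)) (sym length≡))
      (λ i i< → entry i (subst (i <_) (length-applyUpTo (collapseEntry s (expand s v)) (suc s)) i<))
      where
      entry : ∀ i → i < suc s → at (collapse s (expand s v)) i ≡ at v i
      entry i i< with m≤n⇒m<n∨m≡n (≤-pred i<)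
      ... | inj₁ i<s = trans (collapse-before s (expand s v) i i<s) (expand-before s<M v i i<s)
      ... | inj₂ refl = trans (collapse-final s (expand s v)) (expand-final s<M v)

  module Member (w : List ℕ) (dw : IsD321 k (suc M) w) where
    open IsD321 dw

    x : ℕ
    x = at w M

    ≢x : ∀ i → i < M → at w i ≢ x
    ≢x i i<M = distinct i M i<M (n<1+n M)

    x<w[M-1] : x < at w M-1
    x<w[M-1] = proj₁ (shape M-1 (n<1+n M)) k∣M

    -- The descent at B puts w_B below x: otherwise w_{B-1} w_B x would be a 321.
    w[B]<x : at w B < x
    w[B]<x = ≤∧≢⇒< (≮⇒≥ λ x<w[B] → avoids B-1 B M (n<1+n B-1) B<M (n<1+n M) w[B]<w[B-1] x<w[B]) (≢x B B<M)
      where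
      w[B]<w[B-1] : at w B < at w B-1
      w[B]<w[B-1] = proj₁ (shape B-1 (<-trans B<M (n<1+n M))) k∣B

    increasing : IncreasingOn (at w) B M-1
    increasing i B≤i si≤M-1 =
      proj₂ (shape i (s≤s (m≤n⇒m≤1+n si≤M-1))) (no-multiple (suc i) (s≤s B≤i) (s≤s si≤M-1))

    private
      first-above : ∃[ s ] (B ≤ s × s ≤ M-1 × x < at w s × (∀ i → B ≤ i → i < s → ¬ x < at w i))
      first-above = least-witness (λ i → x <? at w i) B M-1 (≤-pred B<M) x<w[M-1]

    s : ℕ
    s = proj₁ first-above

    x<w[s] : x < at w s
    x<w[s] = proj₁ (proj₂ (proj₂ (proj₂ first-above)))

    B<s : B < s
    B<s with m≤n⇒m<n∨m≡n (proj₁ (proj₂ first-above))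
    ... | inj₁ B<s = B<s
    ... | inj₂ B≡s = ⊥-elim (<-asym w[B]<x (subst (λ t → x < at w t) (sym B≡s) x<w[s]))

    s<M : s < M
    s<M = s≤s (proj₁ (proj₂ (proj₂ first-above)))

    below-x : ∀ i → B ≤ i → i < s → at w i < x
    below-x i B≤i i<s =
      ≤∧≢⇒< (≮⇒≥ (proj₂ (proj₂ (proj₂ (proj₂ first-above))) i B≤i i<s)) (≢x i (<-trans i<s s<M))

    -- Every entry before the cut is below w_s: otherwise w_i w_s x would be a 321.
    below-cut : ∀ i → i < s → at w i < at w s
    below-cut i i<s = ≤∧≢⇒< (≮⇒≥ λ ws<wi → avoids i s M i<s s<M (n<1+n M) ws<wi x<w[s])
                             (distinct i s i<s (<-trans s<M (n<1+n M)))

    private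
      C : ℕ → ℕ
      C = at (collapse s w)

    collapse-below-cut : ∀ i → i < suc s → C i < at w s
    collapse-below-cut i i< with m≤n⇒m<n∨m≡n (≤-pred i<)
    ... | inj₁ i<s rewrite collapse-before s w i i<s = below-cut i i<s
    ... | inj₂ refl rewrite collapse-final s w = x<w[s]

    collapse-distinct : ∀ i j → i < j → j < suc s → C i ≢ C j
    collapse-distinct i j i<j j< with m≤n⇒m<n∨m≡n (≤-pred j<)
    ... | inj₁ j<s rewrite collapse-before s w i (<-trans i<j j<s) | collapse-before s w j j<s =
      distinct i j i<j (<-trans (<-trans j<s s<M) (n<1+n M))
    ... | inj₂ refl rewrite collapse-before s w i i<j | collapse-final s w = ≢x i (<-trans i<j s<M)

    -- The s + 1 distinct entries of the collapse lie below w_s, so w_s ≥ s + 1 ...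
    s<w[s] : suc s ≤ at w s
    s<w[s] = pigeonhole (suc s) (at w s) C collapse-below-cut collapse-distinct

    -- ... and the increasing run from s to M-1, ending below M + 1, is forced to be s+1, …, M.
    run : ∀ i → s ≤ i → i < M → at w i ≡ suc i
    run i s≤i i<M = increasing-squeeze (at w) s M-1 1
      (λ j s≤j sj≤ → increasing j (≤-trans (<⇒≤ B<s) s≤j) sj≤) s<w[s]
      (≤-pred (bounded M-1 (<-trans (n<1+n M-1) (n<1+n M)))) i s≤i (≤-pred i<M)

    x≤s : x < suc s
    x≤s = subst (x <_) (run s ≤-refl s<M) x<w[s]

    collapse-isD321 : IsD321 k (suc s) (collapse s w)
    collapse-isD321 = record
      { length≡  = length-applyUpTo (collapseEntry s w) (suc s)
      ; bounded  = λ i i< → subst (C i <_) (run s ≤-refl s<M) (collapse-below-cut i i<)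
      ; distinct = collapse-distinct ; shape = shape′ ; avoids = avoids′ }
      where
      shape′ : ∀ j → suc j < suc s → Step k (suc j) (C j) (C (suc j))
      shape′ j sj< with m≤n⇒m<n∨m≡n (≤-pred sj<)
      ... | inj₁ sj<s rewrite collapse-before s w j (<-trans (n<1+n j) sj<s) | collapse-before s w (suc j) sj<s =
        shape j (<-trans (<-trans sj<s s<M) (n<1+n M))
      ... | inj₂ sj≡s rewrite collapse-before s w j (subst (j <_) sj≡s (n<1+n j))
                            | subst (λ t → C t ≡ x) (sym sj≡s) (collapse-final s w) =
        ascent (subst (B <_) (sym sj≡s) B<s) (subst (_< M) (sym sj≡s) s<M)
               (below-x j (≤-pred (subst (B <_) (sym sj≡s) B<s)) (subst (j <_) sj≡s (n<1+n j)))

      avoids′ : ∀ i j l → i < j → j < l → l < suc s → C j < C i → C l < C j → ⊥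
      avoids′ i j l i<j j<l l< ji lj with m≤n⇒m<n∨m≡n (≤-pred l<)
      ... | inj₁ l<s rewrite collapse-before s w l l<s | collapse-before s w j (<-trans j<l l<s)
                           | collapse-before s w i (<-trans i<j (<-trans j<l l<s)) =
        avoids i j l i<j j<l (<-trans (<-trans l<s s<M) (n<1+n M)) ji lj
      ... | inj₂ refl rewrite collapse-final s w | collapse-before s w j j<l | collapse-before s w i (<-trans i<j j<l) =
        avoids i j M i<j (<-trans j<l s<M) (n<1+n M) ji lj

    expand-collapse : expand s (collapse s w) ≡ w
    expand-collapse = at-ext (expand s (collapse s w)) w
      (trans (length-applyUpTo (expandEntry s (collapse s w)) (suc M)) (sym length≡))
      (λ i i< → entry i (subst (i <_) (length-applyUpTo (expandEntry s (collapse s w)) (suc M)) i<))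
      where
      entry : ∀ i → i < suc M → at (expand s (collapse s w)) i ≡ at w i
      entry i i< with region s i i<
      ... | before i<s     = trans (expand-before s<M (collapse s w) i i<s) (collapse-before s w i i<s)
      ... | inside s≤i i<M = trans (expand-inside s<M (collapse s w) i s≤i i<M) (sym (run i s≤i i<M))
      ... | final refl     = trans (expand-final s<M (collapse s w)) (collapse-final s w)

    cut : CutAt s w
    cut = below-x (pred s) (≤-pred-of B<s) (pred-<-pos B<s) , x<w[s]

    cut-unique : ∀ s′ → B < s′ → s′ < M → CutAt s′ w → s′ ≡ s
    cut-unique s′ B<s′ s′<M (w[s′-1]<x , x<w[s′]) with <-cmp s′ s
    ... | tri< s′<s _ _ = ⊥-elim (<-asym x<w[s′] (below-x s′ (<⇒≤ B<s′) s′<s))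
    ... | tri≈ _ s′≡s _ = s′≡s
    ... | tri> _ _ s<s′ = ⊥-elim (<⇒≱ (<-trans w[s′-1]<x x≤s) (subst (suc s ≤_) (sym w[s′-1]≡s′) s<s′))
      where
      w[s′-1]≡s′ : at w (pred s′) ≡ s′
      w[s′-1]≡s′ = trans (run (pred s′) (≤-pred-of s<s′) (<-trans (pred-<-pos B<s′) s′<M)) (suc-pred-pos B<s′)

  class-size : ∀ s → B < s → s < M → d321 k (suc s) ≡ length (filter (CutAt? s) (D321 k (suc M)))
  class-size s B<s s<M = length-≡-bijection (D321 k (suc s)) (filter (CutAt? s) (D321 k (suc M)))
    (expand s) (collapse s) (D321-unique k (suc s)) (UP.filter⁺ (CutAt? s) (D321-unique k (suc M)))
    expand∈ collapse∈ collapse∘expand expand∘collapse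
    where
    small : ∀ {v} → v ∈ D321 k (suc s) → IsD321 k (suc s) v
    small {v} = to (∈D321⇔ k (suc s) v)

    large : ∀ {w} → w ∈ filter (CutAt? s) (D321 k (suc M)) → IsD321 k (suc M) w
    large {w} w∈ = to (∈D321⇔ k (suc M) w) (proj₁ (∈-filter⁻ (CutAt? s) {xs = D321 k (suc M)} w∈))

    cut≡s : ∀ {w} (w∈ : w ∈ filter (CutAt? s) (D321 k (suc M))) → Member.s w (large w∈) ≡ s
    cut≡s {w} w∈ =
      sym (Member.cut-unique w (large w∈) s B<s s<M (proj₂ (∈-filter⁻ (CutAt? s) {xs = D321 k (suc M)} w∈)))

    expand∈ : ∀ {v} → v ∈ D321 k (suc s) → expand s v ∈ filter (CutAt? s) (D321 k (suc M))
    expand∈ {v} v∈ = ∈-filter⁺ (CutAt? s)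
      (from (∈D321⇔ k (suc M) (expand s v)) (Expand.expand-isD321 s B<s s<M v (small v∈)))
      (Expand.expand-cut s B<s s<M v (small v∈))

    collapse∈ : ∀ {w} → w ∈ filter (CutAt? s) (D321 k (suc M)) → collapse s w ∈ D321 k (suc s)
    collapse∈ {w} w∈ = subst (λ t → collapse t w ∈ D321 k (suc t)) (cut≡s w∈)
      (from (∈D321⇔ k _ _) (Member.collapse-isD321 w (large w∈)))

    collapse∘expand : ∀ {v} → v ∈ D321 k (suc s) → collapse s (expand s v) ≡ v
    collapse∘expand {v} v∈ = Expand.collapse-expand s B<s s<M v (small v∈)

    expand∘collapse : ∀ {w} → w ∈ filter (CutAt? s) (D321 k (suc M)) → expand s (collapse s w) ≡ w
    expand∘collapse {w} w∈ = subst (λ t → expand t (collapse t w) ≡ w) (cut≡s w∈) (Member.expand-collapse w (large w∈))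

  -- Sorting D^k_{M+1}(321) into the classes r - 1 for r = B+2, …, M and counting each class.
  split-count : d321 k (suc M) ≡ sum (map (d321 k) (range (B + 2) M))
  split-count = begin
    length (D321 k (suc M))
      ≡⟨ length-by-classes (λ r → CutAt (pred r)) (λ r → CutAt? (pred r)) R (D321 k (suc M)) one-class ⟩
    sum (map (λ r → length (filter (CutAt? (pred r)) (D321 k (suc M)))) R)
      ≡⟨ cong sum (map-cong-local (All.tabulate each-class)) ⟩
    sum (map (d321 k) R) ∎
    where
    R : List ℕ
    R = range (B + 2) M

    B+2≡ : B + 2 ≡ suc (suc B)
    B+2≡ = +-comm B 2

    bounds : ∀ {r} → r ∈ R → B < pred r × pred r < M × suc (pred r) ≡ r
    bounds {r} r∈ with B+2≤r , r≤M ← to (∈-range⇔ (B + 2) M r) r∈ =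
      ≤-pred-of 1+B<r , <-≤-trans (pred-<-pos 1+B<r) r≤M , suc-pred-pos 1+B<r
      where
      1+B<r : suc B < r
      1+B<r = subst (_≤ r) B+2≡ B+2≤r

    each-class : ∀ {r} → r ∈ R → length (filter (CutAt? (pred r)) (D321 k (suc M))) ≡ d321 k r
    each-class {r} r∈ with B<r-1 , r-1<M , r≡ ← bounds r∈ =
      trans (sym (class-size (pred r) B<r-1 r-1<M)) (cong (d321 k) r≡)

    one-class : ∀ {w} → w ∈ D321 k (suc M) → length (filter (λ r → CutAt? (pred r) w) R) ≡ 1
    one-class {w} w∈ = filter-unique-one (λ r → CutAt? (pred r) w) R (suc s) (range-unique (B + 2) M)
      (from (∈-range⇔ (B + 2) M (suc s)) (subst (_≤ suc s) (sym B+2≡) (s≤s B<s) , s<M)) cut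
      (λ {r} r∈ c → let B<r-1 , r-1<M , r≡ = bounds r∈ in trans (sym r≡) (cong suc (cut-unique (pred r) B<r-1 r-1<M c)))
      where open Member w (to (∈D321⇔ k (suc M) w) w∈)

-- For k, m > 1 the positions B = k(m-1) < M = km are consecutive multiples of k, and
-- the count of module Splitting is the statement.
proposition6p7 : ∀ (k m : ℕ) → 1 < k → 1 < m →
    d321 k (k * m + 1) ≡ sum (map (d321 k) (range (k * (m ∸ 1) + 2) (k * m)))
proposition6p7 k@(suc (suc _)) m@(suc (suc m-2)) (s≤s (s≤s _)) (s≤s (s≤s _)) = begin
  d321 k (k * m + 1)   ≡⟨ cong (d321 k) (+-comm (k * m) 1) ⟩
  d321 k (suc (k * m)) ≡⟨ split-count ⟩
  sum (map (d321 k) (range (k * (m ∸ 1) + 2) (k * m))) ∎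
  where
  open Splitting k _ _ (*-monoʳ-< k (n<1+n (suc m-2))) (m∣m*n (suc m-2)) (m∣m*n m)
                 (no-multiple-between k (suc m-2))
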